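{- Let $k,k'\in\mathbb{N}$ with $k\le k'$, let $\mathcal{H}_{k'}$ be a collection of labelled graphs on $k'$ vertices, and let $(H,\pi)\in\mathcal{H}_{k'}$ with $H=(V_H,E_H)$. Let $G=(V_G,E_G)$ be a graph with colouring $f_G:V_G\to[k]$, $V_G\cap V_H=\emptyset$. (1) If $U\subseteq V_H$ with $|U|=k$ induces a clique in $H$ and there is no $(H',\pi')\in\mathcal{H}_{k'}$ such that $H'$ can be obtained from $H$ by deleting one or more edges with both endpoints in $U$, then, with $\widetilde{G}=\mathcal{C}(G,f_G,H,U)$, $$\mathrm{ColStrEmb}(\mathcal{H}_{k'},\widetilde{G},f_{\widetilde{G}})=\mathrm{ColStrEmb}(\mathcal{H}_{k'}^H,\widetilde{G},f_{\widetilde{G}}).$$ (2) If $W\subseteq V_H$ with $|W|=k$ induces an independent set in $H$ and there is no $(H',\pi')\in\mathcal{H}_{k'}$ such that $H'$ can be obtained from $H$ by adding one or more edges with both endpoints in $W$, then, with $\widehat{G}=\overline{\mathcal{C}}(G,f_G,H,W)$, $$\mathrm{ColStrEmb}(\mathcal{H}_{k'},\widehat{G},f_{\widehat{G}})=\mathrm{ColStrEmb}(\mathcal{H}_{k'}^H,\widehat{G},f_{\widehat{G}}).$$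
   Context: A labelled graph is a pair $(H,\pi)$ with $\pi:[|V(H)|]\to V(H)$ a bijection. For a collection $\mathcal{H}$ of labelled graphs and a graph $H$, $\mathcal{H}^H=\{(H',\pi')\in\mathcal{H}: H'\cong H\}$. For a collection $\mathcal{H}$ of labelled graphs on $m$ vertices and a graph $\Gamma$ with colouring $f$ using colour set $[m]$, $\mathrm{ColStrEmb}(\mathcal{H},\Gamma,f)$ is the number of injective maps $\theta:[m]\to V(\Gamma)$ such that there exists $(H',\pi')\in\mathcal{H}$ with $\theta(i)\theta(j)\in E(\Gamma)\iff\pi'(i)\pi'(j)\in E(H')$ for all $i,j$, and $\theta([m])$ is colourful (contains exactly one vertex of each colour). Construction $\mathcal{C}(G,f_G,H,U)$ for $U$ a $k$-clique of $H$: choose any bijection $f_H:V_H\to[|V_H|]$ with $f_H(U)\subseteq[k]$; let $V_H'=V_H\setminus U$; vertex set $V_G\cup V_H'$; edge set $E_G\cup\{uv\in E_H:u,v\in V_H'\}\cup\{vw:v\in V_G,w\in V_H',\exists u\in U, uw\in E_H, f_H(u)=f_G(v)\}$; colouring $f_{\mathcal{C}}$ equal to $f_H$ on $V_H'$ and $f_G$ on $V_G$. For $W$ a $k$-independent set of $H$ (hence a clique of the complement $\overline{H}$), $\overline{\mathcal{C}}(G,f_G,H,W)$ is the complement graph of $\mathcal{C}(G,f_G,\overline{H},W)$, with the same colouring as $\mathcal{C}(G,f_G,\overline{H},W)$. -}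

module Defs where

open import Data.Nat using (ℕ; zero; suc; _+_; _<_)
open import Data.Bool using (Bool; true; false; not; _∧_; _∨_; if_then_else_)
import Data.Bool as B
open import Data.Fin using (Fin; toℕ; splitAt; _↑ˡ_; _↑ʳ_) renaming (_≟_ to _≟F_)
open import Data.Fin.Properties using (any?; all?)
open import Data.Fin.Permutation using (Permutation′; _⟨$⟩ʳ_; _⟨$⟩ˡ_)
open import Data.Fin.Subset using (Subset)
open import Data.Vec using (Vec; []; _∷_; lookup)
open import Data.List using (List; map; allFin; filter)
open import Data.Nat.ListAction using (sum)
open import Data.List.Relation.Unary.Any using (Any)
import Data.List.Relation.Unary.Any as Any
open import Data.Sum using (_⊎_; inj₁; inj₂; [_,_]′)
open import Data.Product using (Σ; ∃; _×_; _,_)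
open import Relation.Nullary using (Dec; yes; no; ¬_)
open import Relation.Nullary.Decidable using (⌊_⌋; _×-dec_; _→-dec_)
open import Relation.Binary.PropositionalEquality using (_≡_; refl; sym; trans; cong)

record Graph (n : ℕ) : Set where
  field
    adj    : Fin n → Fin n → Bool
    adj-sym    : ∀ x y → adj x y ≡ adj y x
    adj-irrefl : ∀ x → adj x x ≡ false
open Graph public

record LGraph (m : ℕ) : Set where
  field
    graph : Graph m
    label : Permutation′ m
open LGraph public

count : ∀ m {N : ℕ} (P : Vec (Fin N) m → Set) → (∀ v → Dec (P v)) → ℕ
count zero    P P? = if ⌊ P? [] ⌋ then 1 else 0
count (suc m) {N} P P? =
  sum (map (λ a → count m (λ v → P (a ∷ v)) (λ v → P? (a ∷ v))) (allFin N))

∃vec? : ∀ m {N : ℕ} {P : Vec (Fin N) m → Set} → (∀ v → Dec (P v)) →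
        Dec (∃ λ (v : Vec (Fin N) m) → P v)
∃vec? zero P? with P? []
... | yes p = yes ([] , p)
... | no ¬p = no λ { ([] , p) → ¬p p }
∃vec? (suc m) {P = P} P? with any? (λ a → ∃vec? m {P = λ v → P (a ∷ v)} (λ v → P? (a ∷ v)))
... | yes (a , v , p) = yes (a ∷ v , p)
... | no ¬q = no λ { (a ∷ v , p) → ¬q (a , v , p) }

anyF : ∀ {n} → (Fin n → Bool) → Bool
anyF {zero}  f = false
anyF {suc n} f = f Fin.zero ∨ anyF (λ i → f (Fin.suc i))
  where import Data.Fin as Fin

InjVec : ∀ {m N} → Vec (Fin N) m → Set
InjVec {m} θ = ∀ (i j : Fin m) → lookup θ i ≡ lookup θ j → i ≡ j

injVec? : ∀ {m N} (θ : Vec (Fin N) m) → Dec (InjVec θ)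
injVec? θ = all? λ i → all? λ j → (lookup θ i ≟F lookup θ j) →-dec (i ≟F j)

Iso : ∀ {m} → Graph m → Graph m → Set
Iso {m} G H = ∃ λ (σ : Vec (Fin m) m) →
  InjVec σ × (∀ x y → adj G x y ≡ adj H (lookup σ x) (lookup σ y))

iso? : ∀ {m} (G H : Graph m) → Dec (Iso G H)
iso? {m} G H = ∃vec? m λ σ → injVec? σ ×-dec
  (all? λ x → all? λ y → adj G x y B.≟ adj H (lookup σ x) (lookup σ y))

restrict : ∀ {m} → List (LGraph m) → Graph m → List (LGraph m)
restrict 𝓗 H = filter (λ L → iso? (graph L) H) 𝓗

Match : ∀ {m N} → Graph N → Vec (Fin N) m → LGraph m → Set
Match {m} Γ θ L = ∀ (i j : Fin m) →
  adj Γ (lookup θ i) (lookup θ j) ≡ adj (graph L) (label L ⟨$⟩ʳ i) (label L ⟨$⟩ʳ j)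

match? : ∀ {m N} (Γ : Graph N) (θ : Vec (Fin N) m) (L : LGraph m) → Dec (Match Γ θ L)
match? Γ θ L = all? λ i → all? λ j → _ B.≟ _

Colourful : ∀ {m N} → (Fin N → Fin m) → Vec (Fin N) m → Set
Colourful {m} f θ = ∀ (c : Fin m) →
  (∃ λ (i : Fin m) → f (lookup θ i) ≡ c) ×
  (∀ (i j : Fin m) → f (lookup θ i) ≡ c → f (lookup θ j) ≡ c → lookup θ i ≡ lookup θ j)

colourful? : ∀ {m N} (f : Fin N → Fin m) (θ : Vec (Fin N) m) → Dec (Colourful f θ)
colourful? f θ = all? λ c → any? (λ i → f (lookup θ i) ≟F c) ×-dec
  (all? λ i → all? λ j → (f (lookup θ i) ≟F c) →-dec ((f (lookup θ j) ≟F c) →-dec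
     (lookup θ i ≟F lookup θ j)))

ColStrEmbPred : ∀ {m N} → List (LGraph m) → Graph N → (Fin N → Fin m) →
                Vec (Fin N) m → Set
ColStrEmbPred 𝓗 Γ f θ = InjVec θ × Any (Match Γ θ) 𝓗 × Colourful f θ

ColStrEmb : ∀ {m N} → List (LGraph m) → Graph N → (Fin N → Fin m) → ℕ
ColStrEmb {m} 𝓗 Γ f = count m (ColStrEmbPred 𝓗 Γ f)
  (λ θ → injVec? θ ×-dec Any.any? (match? Γ θ) 𝓗 ×-dec colourful? f θ)

_∈ˢ_ : ∀ {n} → Fin n → Subset n → Set
u ∈ˢ U = lookup U u ≡ true

IsClique : ∀ {n} → Graph n → Subset n → Set
IsClique H U = ∀ u v → u ∈ˢ U → v ∈ˢ U → ¬ (u ≡ v) → adj H u v ≡ true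

IsIndependent : ∀ {n} → Graph n → Subset n → Set
IsIndependent H W = ∀ u v → u ∈ˢ W → v ∈ˢ W → adj H u v ≡ false

compAdj : ∀ {n} → Graph n → Fin n → Fin n → Bool
compAdj H x y = if ⌊ x ≟F y ⌋ then false else not (adj H x y)

compAdj-sym : ∀ {n} (H : Graph n) x y → compAdj H x y ≡ compAdj H y x
compAdj-sym H x y with x ≟F y | y ≟F x
... | yes _ | yes _ = refl
... | yes p | no ¬q = Data.Empty.⊥-elim (¬q (sym p))
  where import Data.Empty
... | no ¬p | yes q = Data.Empty.⊥-elim (¬p (sym q))
  where import Data.Empty
... | no _ | no _ = cong not (adj-sym H x y)

compAdj-irrefl : ∀ {n} (H : Graph n) x → compAdj H x x ≡ false
compAdj-irrefl H x with x ≟F x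
... | yes _ = refl
... | no ¬p = Data.Empty.⊥-elim (¬p refl)
  where import Data.Empty

complement : ∀ {n} → Graph n → Graph n
complement H = record { adj = compAdj H ; adj-sym = compAdj-sym H ; adj-irrefl = compAdj-irrefl H }

DeletedWithin : ∀ {n} → Graph n → Subset n → Graph n → Set
DeletedWithin H U D =
  (∀ x y → adj D x y ≡ true → adj H x y ≡ true) ×
  (∀ x y → adj H x y ≡ true → adj D x y ≡ false → x ∈ˢ U × y ∈ˢ U) ×
  (∃ λ x → ∃ λ y → adj H x y ≡ true × adj D x y ≡ false)

AddedWithin : ∀ {n} → Graph n → Subset n → Graph n → Set
AddedWithin H W A =
  (∀ x y → adj H x y ≡ true → adj A x y ≡ true) ×
  (∀ x y → adj A x y ≡ true → adj H x y ≡ false → x ∈ˢ W × y ∈ˢ W) ×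
  (∃ λ x → ∃ λ y → adj A x y ≡ true × adj H x y ≡ false)

-- H has k + r vertices, G has n vertices, f_G : V_G → [k],
-- f_H : V_H → [k + r] a bijection (intended: f_H(U) ⊆ [k]).
-- Vertex set V_G ⊔ V_H' is represented by Fin (n + r): the first n vertices
-- are V_G, and vertex n + j (j : Fin r) is the H-vertex w_j = f_H⁻¹(k + j).
-- When f_H(U) ⊆ [k] and |U| = k, j ↦ w_j is a bijection Fin r ≅ V_H \ U.

module Construction {k r n : ℕ} (G : Graph n) (fG : Fin n → Fin k)
                    (H : Graph (k + r)) (U : Subset (k + r))
                    (fH : Permutation′ (k + r)) where

  w : Fin r → Fin (k + r)
  w j = fH ⟨$⟩ˡ (k ↑ʳ j)

  cross : Fin n → Fin r → Bool
  cross v j = anyF λ u → lookup U u ∧ adj H u (w j) ∧ ⌊ fH ⟨$⟩ʳ u ≟F (fG v ↑ˡ r) ⌋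

  adj⊎ : Fin n ⊎ Fin r → Fin n ⊎ Fin r → Bool
  adj⊎ (inj₁ a) (inj₁ b) = adj G a b
  adj⊎ (inj₂ i) (inj₂ j) = adj H (w i) (w j)
  adj⊎ (inj₁ a) (inj₂ j) = cross a j
  adj⊎ (inj₂ i) (inj₁ b) = cross b i

  adj⊎-sym : ∀ x y → adj⊎ x y ≡ adj⊎ y x
  adj⊎-sym (inj₁ a) (inj₁ b) = adj-sym G a b
  adj⊎-sym (inj₂ i) (inj₂ j) = adj-sym H (w i) (w j)
  adj⊎-sym (inj₁ a) (inj₂ j) = refl
  adj⊎-sym (inj₂ i) (inj₁ b) = refl

  adj⊎-irrefl : ∀ x → adj⊎ x x ≡ false
  adj⊎-irrefl (inj₁ a) = adj-irrefl G a
  adj⊎-irrefl (inj₂ i) = adj-irrefl H (w i)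

  graph𝓒 : Graph (n + r)
  graph𝓒 = record
    { adj    = λ x y → adj⊎ (splitAt n x) (splitAt n y)
    ; adj-sym    = λ x y → adj⊎-sym (splitAt n x) (splitAt n y)
    ; adj-irrefl = λ x → adj⊎-irrefl (splitAt n x)
    }

𝓒 : ∀ {k r n} → Graph n → (Fin n → Fin k) → Graph (k + r) → Subset (k + r) →
    Permutation′ (k + r) → Graph (n + r)
𝓒 G fG H U fH = Construction.graph𝓒 G fG H U fH

-- colouring f_𝓒 : f_G on V_G, f_H on V_H' (f_H(w_j) = k + j)
f𝓒 : ∀ {k r n} → (Fin n → Fin k) → Fin (n + r) → Fin (k + r)
f𝓒 {k} {r} {n} fG x = [ (λ a → fG a ↑ˡ r) , (λ j → k ↑ʳ j) ]′ (splitAt n x)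

𝓒bar : ∀ {k r n} → Graph n → (Fin n → Fin k) → Graph (k + r) → Subset (k + r) →
       Permutation′ (k + r) → Graph (n + r)
𝓒bar G fG H W fH = complement (𝓒 G fG (complement H) W fH)

-- Let θ be a colourful copy in 𝓒(G, f_G, H, U) of a member K of 𝓗, and pull the edges of 𝓒
-- back to V_H along x ↦ (the vertex of θ coloured f_H(x)); the resulting graph is isomorphic
-- to K.  Since |U| = k and f_H(U) ⊆ [k], the vertices of V_H of colour < k are exactly those
-- of U (pigeonhole).  A vertex x ∉ U is sent to x itself, and u ∈ U to a vertex of G whose
-- neighbours in V_H ∖ U are those of u.  So the pulled-back graph agrees with H off U × U and
-- can only lose edges inside the clique U; by hypothesis it loses none, hence K ≅ H.
-- Part (2) is part (1) for the complements of H and of the members of 𝓗.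
module Submission where

open import Defs
open import Data.Nat using (ℕ; zero; suc; _+_; _<_; _≤_; z≤n; s≤s)
open import Data.Nat.Properties using (<-irrefl; module ≤-Reasoning)
open import Data.Nat.ListAction using (sum)
open import Data.Bool using (Bool; true; false; not; _∧_)
open import Data.Bool.Properties using (∧-identityʳ; ∧-zeroʳ; ∨-identityʳ; not-involutive; not-injective; ¬-not)
import Data.Bool as Bool
open import Data.Fin using (Fin; toℕ; splitAt; _↑ˡ_; _↑ʳ_) renaming (_≟_ to _≟F_)
import Data.Fin as Fin
open import Data.Fin.Properties using (toℕ-↑ˡ; toℕ<n; suc-injective; 0≢1+n; any?)
open import Data.Fin.Subset using (Subset; ∣_∣; ⊤; ⊥)
open import Data.Fin.Subset.Properties using (∣⊥∣≡0)
open import Data.Fin.Permutation using (Permutation′; _⟨$⟩ʳ_; _⟨$⟩ˡ_; inverseˡ; inverseʳ)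
open import Data.List using (List; allFin; filter)
open import Data.List.Properties using (map-cong)
open import Data.List.Membership.Propositional using (_∈_; find; lose)
open import Data.List.Membership.Propositional.Properties using (∈-filter⁺)
open import Data.List.Relation.Unary.Any using (Any)
open import Data.List.Relation.Unary.Any.Properties using (filter⁻)
open import Data.Vec using (Vec; []; _∷_; lookup; tabulate; _[_]≔_; _++_)
open import Data.Vec.Properties using (lookup∘tabulate; lookup∘update′)
open import Data.Sum using (_⊎_; inj₁; inj₂; [_,_]′)
open import Data.Product using (_×_; _,_; proj₁; proj₂; ∃)
open import Data.Empty using (⊥-elim)
open import Function using (_⇔_; mk⇔; Equivalence)
open import Function.Definitions using (Injective)
open import Relation.Nullary using (¬_; Dec; yes; no; contradiction)
open import Relation.Nullary.Decidable using (⌊_⌋; isYes≗does; dec-true; dec-false; _×-dec_)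
open import Relation.Unary using (Pred; Decidable)
open import Relation.Binary.PropositionalEquality
  using (_≡_; _≢_; refl; sym; trans; cong; cong₂; subst; module ≡-Reasoning)

count-cong : ∀ m {N} {P Q : Vec (Fin N) m → Set} (P? : ∀ v → Dec (P v)) (Q? : ∀ v → Dec (Q v)) →
             (∀ v → P v ⇔ Q v) → count m P P? ≡ count m Q Q?
count-cong zero P? Q? P⇔Q with P? [] | Q? []
... | yes _ | yes _ = refl
... | no _  | no _  = refl
... | yes p | no ¬q = contradiction (Equivalence.to (P⇔Q []) p) ¬q
... | no ¬p | yes q = contradiction (Equivalence.from (P⇔Q []) q) ¬p
count-cong (suc m) {N} P? Q? P⇔Q = cong sum (map-cong
  (λ a → count-cong m (λ v → P? (a ∷ v)) (λ v → Q? (a ∷ v)) (λ v → P⇔Q (a ∷ v))) (allFin N))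

Any-filter⁺ : ∀ {a p q} {A : Set a} {P : Pred A p} {Q : Pred A q} (Q? : Decidable Q) {xs : List A} →
              (∀ {x} → x ∈ xs → P x → Q x) → Any P xs → Any P (filter Q? xs)
Any-filter⁺ Q? P⇒Q any with find any
... | x , x∈xs , px = lose (∈-filter⁺ Q? x∈xs (P⇒Q x∈xs px)) px

ColStrEmb-restrict : ∀ {m N} (𝓗 : List (LGraph m)) (Γ : Graph N) (f : Fin N → Fin m) (H : Graph m) →
  (∀ θ → InjVec θ → Colourful f θ → ∀ {L} → L ∈ 𝓗 → Match Γ θ L → Iso (graph L) H) →
  ColStrEmb 𝓗 Γ f ≡ ColStrEmb (restrict 𝓗 H) Γ f
ColStrEmb-restrict {m} 𝓗 Γ f H copies = count-cong m _ _ λ θ → mk⇔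
  (λ (inj , match , col) → inj , Any-filter⁺ isoH? (copies θ inj col) match , col)
  (λ (inj , match , col) → inj , filter⁻ isoH? match , col)
  where
  isoH? = λ (L : LGraph m) → iso? (graph L) H

∣p[x]≔false∣ : ∀ {N} (p : Subset N) {x} → x ∈ˢ p → ∣ p ∣ ≡ suc ∣ p [ x ]≔ false ∣
∣p[x]≔false∣ (true ∷ p)  {Fin.zero}  _   = refl
∣p[x]≔false∣ (true ∷ p)  {Fin.suc x} x∈p = cong suc (∣p[x]≔false∣ p x∈p)
∣p[x]≔false∣ (false ∷ p) {Fin.suc x} x∈p = ∣p[x]≔false∣ p x∈p

∣p[x]≔true∣ : ∀ {N} (p : Subset N) {x} → lookup p x ≡ false → ∣ p [ x ]≔ true ∣ ≡ suc ∣ p ∣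
∣p[x]≔true∣ (false ∷ p) {Fin.zero}  _   = refl
∣p[x]≔true∣ (true ∷ p)  {Fin.suc x} x∉p = cong suc (∣p[x]≔true∣ p x∉p)
∣p[x]≔true∣ (false ∷ p) {Fin.suc x} x∉p = ∣p[x]≔true∣ p x∉p

injection⇒∣p∣≤∣q∣ : ∀ {N M} {g : Fin N → Fin M} → Injective _≡_ _≡_ g →
  (p : Subset N) (q : Subset M) → (∀ x → x ∈ˢ p → g x ∈ˢ q) → ∣ p ∣ ≤ ∣ q ∣
injection⇒∣p∣≤∣q∣         g-inj []          q g[p]⊆q = z≤n
injection⇒∣p∣≤∣q∣         g-inj (false ∷ p) q g[p]⊆q =
  injection⇒∣p∣≤∣q∣ (λ e → suc-injective (g-inj e)) p q (λ x → g[p]⊆q (Fin.suc x))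
injection⇒∣p∣≤∣q∣ {g = g} g-inj (true ∷ p)  q g[p]⊆q =
  subst (suc ∣ p ∣ ≤_) (sym (∣p[x]≔false∣ q (g[p]⊆q Fin.zero refl)))
    (s≤s (injection⇒∣p∣≤∣q∣ (λ e → suc-injective (g-inj e)) p (q [ g Fin.zero ]≔ false) g[p]⊆q′))
  where
  g[p]⊆q′ : ∀ x → x ∈ˢ p → g (Fin.suc x) ∈ˢ (q [ g Fin.zero ]≔ false)
  g[p]⊆q′ x x∈p = trans (lookup∘update′ (λ e → 0≢1+n (g-inj (sym e))) q false) (g[p]⊆q (Fin.suc x) x∈p)

-- Pigeonhole: adding x to p would give an injection of a larger set into q.
injection-reflects-∈ : ∀ {N M} {g : Fin N → Fin M} → Injective _≡_ _≡_ g →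
  (p : Subset N) (q : Subset M) → (∀ x → x ∈ˢ p → g x ∈ˢ q) → ∣ p ∣ ≡ ∣ q ∣ →
  ∀ x → g x ∈ˢ q → x ∈ˢ p
injection-reflects-∈ {g = g} g-inj p q g[p]⊆q ∣p∣≡∣q∣ x gx∈q with lookup p x in x∉p
... | true  = refl
... | false = ⊥-elim (<-irrefl refl (begin
  suc ∣ p ∣          ≡⟨ ∣p[x]≔true∣ p x∉p ⟨
  ∣ p [ x ]≔ true ∣  ≤⟨ injection⇒∣p∣≤∣q∣ g-inj (p [ x ]≔ true) q g[p+x]⊆q ⟩
  ∣ q ∣              ≡⟨ ∣p∣≡∣q∣ ⟨
  ∣ p ∣              ∎))
  where
  open ≤-Reasoning
  g[p+x]⊆q : ∀ y → y ∈ˢ (p [ x ]≔ true) → g y ∈ˢ q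
  g[p+x]⊆q y y∈p+x with y ≟F x
  ... | yes refl = gx∈q
  ... | no y≢x   = g[p]⊆q y (trans (sym (lookup∘update′ y≢x p true)) y∈p+x)

initialSegment : ∀ k r → Subset (k + r)
initialSegment k r = ⊤ {k} ++ ⊥ {r}

∣initialSegment∣ : ∀ k r → ∣ initialSegment k r ∣ ≡ k
∣initialSegment∣ zero    r = ∣⊥∣≡0 r
∣initialSegment∣ (suc k) r = cong suc (∣initialSegment∣ k r)

∈-initialSegment : ∀ k r {c : Fin (k + r)} → toℕ c < k → c ∈ˢ initialSegment k r
∈-initialSegment (suc k) r {Fin.zero}  _         = refl
∈-initialSegment (suc k) r {Fin.suc c} (s≤s c<k) = ∈-initialSegment k r c<k

⟨$⟩ʳ-injective : ∀ {m} (π : Permutation′ m) → Injective _≡_ _≡_ (π ⟨$⟩ʳ_)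
⟨$⟩ʳ-injective π e = trans (sym (inverseˡ π)) (trans (cong (π ⟨$⟩ˡ_) e) (inverseˡ π))

small-colour⇒∈ : ∀ k r (U : Subset (k + r)) (fH : Permutation′ (k + r)) → ∣ U ∣ ≡ k →
  (∀ u → u ∈ˢ U → toℕ (fH ⟨$⟩ʳ u) < k) → ∀ x → toℕ (fH ⟨$⟩ʳ x) < k → x ∈ˢ U
small-colour⇒∈ k r U fH ∣U∣≡k fH[U]<k x fHx<k =
  injection-reflects-∈ (⟨$⟩ʳ-injective fH) U (initialSegment k r)
    (λ u u∈U → ∈-initialSegment k r (fH[U]<k u u∈U))
    (trans ∣U∣≡k (sym (∣initialSegment∣ k r))) x (∈-initialSegment k r fHx<k)

pullback : ∀ {m N} → Graph N → (Fin m → Fin N) → Graph m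
pullback Γ t = record
  { adj        = λ x y → adj Γ (t x) (t y)
  ; adj-sym    = λ x y → adj-sym Γ (t x) (t y)
  ; adj-irrefl = λ x → adj-irrefl Γ (t x)
  }

module _ {m N} {f : Fin N → Fin m} {θ : Vec (Fin N) m} (col : Colourful f θ) where

  vertexOfColour : Fin m → Fin N
  vertexOfColour c = lookup θ (proj₁ (proj₁ (col c)))

  colour-vertexOfColour : ∀ c → f (vertexOfColour c) ≡ c
  colour-vertexOfColour c = proj₂ (proj₁ (col c))

  vertexOfColour-colour : ∀ i → vertexOfColour (f (lookup θ i)) ≡ lookup θ i
  vertexOfColour-colour i = proj₂ (col (f (lookup θ i))) _ i (colour-vertexOfColour _) refl

  Match⇒Iso-pullback : ∀ (Γ : Graph N) (ρ : Permutation′ m) → InjVec θ → (K : LGraph m) →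
    Match Γ θ K → Iso (graph K) (pullback Γ (λ x → vertexOfColour (ρ ⟨$⟩ʳ x)))
  Match⇒Iso-pullback Γ ρ inj K match = tabulate σ , σ-inj , σ-preserves-adj
    where
    open ≡-Reasoning
    π = label K

    σ : Fin m → Fin m
    σ x = ρ ⟨$⟩ˡ f (lookup θ (π ⟨$⟩ˡ x))

    t : Fin m → Fin N
    t x = vertexOfColour (ρ ⟨$⟩ʳ x)

    t∘σ : ∀ x → t (σ x) ≡ lookup θ (π ⟨$⟩ˡ x)
    t∘σ x = trans (cong vertexOfColour (inverseʳ ρ)) (vertexOfColour-colour (π ⟨$⟩ˡ x))

    σ-inj : InjVec (tabulate σ)
    σ-inj x y e = trans (sym (inverseʳ π)) (trans (cong (π ⟨$⟩ʳ_) (inj _ _ θ-eq)) (inverseʳ π))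
      where
      θ-eq : lookup θ (π ⟨$⟩ˡ x) ≡ lookup θ (π ⟨$⟩ˡ y)
      θ-eq = begin
        lookup θ (π ⟨$⟩ˡ x) ≡⟨ t∘σ x ⟨
        t (σ x)             ≡⟨ cong t (trans (sym (lookup∘tabulate σ x)) (trans e (lookup∘tabulate σ y))) ⟩
        t (σ y)             ≡⟨ t∘σ y ⟩
        lookup θ (π ⟨$⟩ˡ y) ∎

    σ-preserves-adj : ∀ x y → adj (graph K) x y ≡ adj Γ (t (lookup (tabulate σ) x)) (t (lookup (tabulate σ) y))
    σ-preserves-adj x y = begin
      adj (graph K) x y
        ≡⟨ cong₂ (adj (graph K)) (inverseʳ π) (inverseʳ π) ⟨
      adj (graph K) (π ⟨$⟩ʳ (π ⟨$⟩ˡ x)) (π ⟨$⟩ʳ (π ⟨$⟩ˡ y))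
        ≡⟨ match (π ⟨$⟩ˡ x) (π ⟨$⟩ˡ y) ⟨
      adj Γ (lookup θ (π ⟨$⟩ˡ x)) (lookup θ (π ⟨$⟩ˡ y))
        ≡⟨ cong₂ (adj Γ) (t∘σ x) (t∘σ y) ⟨
      adj Γ (t (σ x)) (t (σ y))
        ≡⟨ cong₂ (λ a b → adj Γ (t a) (t b)) (lookup∘tabulate σ x) (lookup∘tabulate σ y) ⟨
      adj Γ (t (lookup (tabulate σ) x)) (t (lookup (tabulate σ) y)) ∎

Iso-resp-≗ : ∀ {m} {A A′ B B′ : Graph m} → (∀ x y → adj A′ x y ≡ adj A x y) →
             (∀ x y → adj B x y ≡ adj B′ x y) → Iso A B → Iso A′ B′
Iso-resp-≗ A′≗A B≗B′ (σ , σ-inj , σ-adj) =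
  σ , σ-inj , λ x y → trans (A′≗A x y) (trans (σ-adj x y) (B≗B′ _ _))

adj-true⇒≢ : ∀ {m} (H : Graph m) {x y} → adj H x y ≡ true → x ≢ y
adj-true⇒≢ H {x} e refl with trans (sym e) (adj-irrefl H x)
... | ()

≗-or-DeletedWithin : ∀ {m} (H D : Graph m) (U : Subset m) → IsClique H U →
  (∀ x y → (x ∈ˢ U × y ∈ˢ U) ⊎ (adj D x y ≡ adj H x y)) →
  (∀ x y → adj D x y ≡ adj H x y) ⊎ DeletedWithin H U D
≗-or-DeletedWithin H D U clique agree
  with any? (λ x → any? λ y → (adj H x y Bool.≟ true) ×-dec (adj D x y Bool.≟ false))
... | yes deleted = inj₂ (D⊆H , deletedInside , deleted)
  where
  D⊆H : ∀ x y → adj D x y ≡ true → adj H x y ≡ true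
  D⊆H x y d with agree x y
  ... | inj₁ (x∈U , y∈U) = clique x y x∈U y∈U (adj-true⇒≢ D d)
  ... | inj₂ D≡H         = trans (sym D≡H) d

  deletedInside : ∀ x y → adj H x y ≡ true → adj D x y ≡ false → x ∈ˢ U × y ∈ˢ U
  deletedInside x y h d with agree x y
  ... | inj₁ inside = inside
  ... | inj₂ D≡H with trans (sym d) (trans D≡H h)
  ... | ()
... | no nothingDeleted = inj₁ D≗H
  where
  D≗H : ∀ x y → adj D x y ≡ adj H x y
  D≗H x y with agree x y
  ... | inj₂ D≡H = D≡H
  ... | inj₁ (x∈U , y∈U) with adj D x y in d | adj H x y in h
  ...   | true  | true  = refl
  ...   | false | false = refl
  ...   | true  | false = trans (sym (clique x y x∈U y∈U (adj-true⇒≢ D d))) h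
  ...   | false | true  = ⊥-elim (nothingDeleted (x , y , h , d))

anyF-false : ∀ {M} (h : Fin M → Bool) → (∀ u → h u ≡ false) → anyF h ≡ false
anyF-false {zero}  h _   = refl
anyF-false {suc M} h all rewrite all Fin.zero = anyF-false (λ i → h (Fin.suc i)) (λ u → all (Fin.suc u))

anyF-single : ∀ {M} (h : Fin M → Bool) (x : Fin M) → (∀ u → u ≢ x → h u ≡ false) → anyF h ≡ h x
anyF-single {suc M} h Fin.zero others = trans
  (cong (h Fin.zero Bool.∨_) (anyF-false (λ i → h (Fin.suc i)) λ u → others (Fin.suc u) λ ()))
  (∨-identityʳ _)
anyF-single {suc M} h (Fin.suc x) others rewrite others Fin.zero (λ ()) =
  anyF-single (λ i → h (Fin.suc i)) x (λ u u≢x → others (Fin.suc u) (λ e → u≢x (suc-injective e)))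

module CliqueGadget {k r n : ℕ} (G : Graph n) (fG : Fin n → Fin k) (H : Graph (k + r))
                    (U : Subset (k + r)) (fH : Permutation′ (k + r))
                    (∣U∣≡k : ∣ U ∣ ≡ k) (fH[U]<k : ∀ u → u ∈ˢ U → toℕ (fH ⟨$⟩ʳ u) < k) where

  open Construction G fG H U fH
  open ≡-Reasoning

  colour⊎ : Fin n ⊎ Fin r → Fin (k + r)
  colour⊎ = [ (λ a → fG a ↑ˡ r) , (k ↑ʳ_) ]′

  G-colour⇒∈U : ∀ a x → fG a ↑ˡ r ≡ fH ⟨$⟩ʳ x → x ∈ˢ U
  G-colour⇒∈U a x e = small-colour⇒∈ k r U fH ∣U∣≡k fH[U]<k x
    (subst (λ c → toℕ c < k) e (subst (_< k) (sym (toℕ-↑ˡ (fG a) r)) (toℕ<n (fG a))))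

  H-colour⇒w : ∀ i x → k ↑ʳ i ≡ fH ⟨$⟩ʳ x → w i ≡ x
  H-colour⇒w i x e = trans (cong (fH ⟨$⟩ˡ_) e) (inverseˡ fH)

  cross≡adj : ∀ a j x → fG a ↑ˡ r ≡ fH ⟨$⟩ʳ x → cross a j ≡ adj H x (w j)
  cross≡adj a j x e = begin
    anyF h                ≡⟨ anyF-single h x others ⟩
    h x                   ≡⟨ cong₂ (λ b c → b ∧ adj H x (w j) ∧ c) (G-colour⇒∈U a x e)
                               (trans (isYes≗does (_ ≟F _)) (dec-true (_ ≟F _) (sym e))) ⟩
    adj H x (w j) ∧ true  ≡⟨ ∧-identityʳ _ ⟩
    adj H x (w j)         ∎
    where
    h : Fin (k + r) → Bool
    h u = lookup U u ∧ adj H u (w j) ∧ ⌊ fH ⟨$⟩ʳ u ≟F (fG a ↑ˡ r) ⌋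
    others : ∀ u → u ≢ x → h u ≡ false
    others u u≢x = begin
      h u                                  ≡⟨ cong (λ c → lookup U u ∧ adj H u (w j) ∧ c)
                                                (trans (isYes≗does (_ ≟F _))
                                                  (dec-false (_ ≟F _) λ e′ → u≢x (⟨$⟩ʳ-injective fH (trans e′ e)))) ⟩
      lookup U u ∧ adj H u (w j) ∧ false   ≡⟨ cong (lookup U u ∧_) (∧-zeroʳ _) ⟩
      lookup U u ∧ false                   ≡⟨ ∧-zeroʳ _ ⟩
      false                                ∎

  adj⊎-agrees-outside-U : ∀ x y (s s′ : Fin n ⊎ Fin r) →
    colour⊎ s ≡ fH ⟨$⟩ʳ x → colour⊎ s′ ≡ fH ⟨$⟩ʳ y → (x ∈ˢ U × y ∈ˢ U) ⊎ (adj⊎ s s′ ≡ adj H x y)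
  adj⊎-agrees-outside-U x y (inj₁ a) (inj₁ b) e e′ = inj₁ (G-colour⇒∈U a x e , G-colour⇒∈U b y e′)
  adj⊎-agrees-outside-U x y (inj₂ i) (inj₂ j) e e′ =
    inj₂ (cong₂ (adj H) (H-colour⇒w i x e) (H-colour⇒w j y e′))
  adj⊎-agrees-outside-U x y (inj₁ a) (inj₂ j) e e′ =
    inj₂ (trans (cross≡adj a j x e) (cong (adj H x) (H-colour⇒w j y e′)))
  adj⊎-agrees-outside-U x y (inj₂ i) (inj₁ b) e e′ =
    inj₂ (trans (cross≡adj b i y e′) (trans (cong (adj H y) (H-colour⇒w i x e)) (adj-sym H y x)))

  copies : IsClique H U → ∀ θ → InjVec θ → Colourful (f𝓒 fG) θ → (K : LGraph (k + r)) →
    Match (𝓒 G fG H U fH) θ K → Iso (graph K) H ⊎ ∃ λ D → DeletedWithin H U D × Iso (graph K) D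
  copies clique θ inj col K match =
    [ (λ D≗H → inj₁ (Iso-resp-≗ {A = graph K} {graph K} {D} {H} (λ _ _ → refl) D≗H K≅D))
    , (λ deleted → inj₂ (D , deleted , K≅D))
    ]′
      (≗-or-DeletedWithin H D U clique agree)
    where
    t : Fin (k + r) → Fin (n + r)
    t x = vertexOfColour {f = f𝓒 fG} {θ} col (fH ⟨$⟩ʳ x)

    D : Graph (k + r)
    D = pullback (𝓒 G fG H U fH) t

    K≅D : Iso (graph K) D
    K≅D = Match⇒Iso-pullback {f = f𝓒 fG} {θ} col (𝓒 G fG H U fH) fH inj K match

    agree : ∀ x y → (x ∈ˢ U × y ∈ˢ U) ⊎ (adj D x y ≡ adj H x y)
    agree x y = adj⊎-agrees-outside-U x y (splitAt n (t x)) (splitAt n (t y))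
      (colour-vertexOfColour {f = f𝓒 fG} {θ} col (fH ⟨$⟩ʳ x))
      (colour-vertexOfColour {f = f𝓒 fG} {θ} col (fH ⟨$⟩ʳ y))

compAdj-≢ : ∀ {m} (H : Graph m) {x y} → x ≢ y → compAdj H x y ≡ not (adj H x y)
compAdj-≢ H {x} {y} x≢y with x ≟F y
... | yes x≡y = contradiction x≡y x≢y
... | no _    = refl

compAdj-true : ∀ {m} (H : Graph m) {x y} → compAdj H x y ≡ true → adj H x y ≡ false
compAdj-true H e = not-injective (trans (sym (compAdj-≢ H (adj-true⇒≢ (complement H) e))) e)

compAdj-false⇒true : ∀ {m} (H : Graph m) {x y} → x ≢ y → adj H x y ≡ false → compAdj H x y ≡ true
compAdj-false⇒true H x≢y e = trans (compAdj-≢ H x≢y) (cong not e)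

complement-involutive : ∀ {m} (H : Graph m) x y → compAdj (complement H) x y ≡ adj H x y
complement-involutive H x y with x ≟F y
... | yes refl = sym (adj-irrefl H x)
... | no _     = not-involutive _

Iso-complement : ∀ {m} (A B : Graph m) → Iso A B → Iso (complement A) (complement B)
Iso-complement A B (σ , σ-inj , σ-adj) = σ , σ-inj , σ-compAdj
  where
  σ-compAdj : ∀ x y → compAdj A x y ≡ compAdj B (lookup σ x) (lookup σ y)
  σ-compAdj x y with x ≟F y
  ... | yes refl = sym (compAdj-irrefl B _)
  ... | no x≢y   = sym (trans (compAdj-≢ B (λ e → x≢y (σ-inj x y e))) (cong not (sym (σ-adj x y))))

Iso-complementˡ : ∀ {m} (A B : Graph m) → Iso (complement A) B → Iso A (complement B)
Iso-complementˡ A B Ā≅B = Iso-resp-≗ {A = complement (complement A)} {A} {complement B} {complement B}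
  (λ x y → sym (complement-involutive A x y)) (λ _ _ → refl) (Iso-complement (complement A) B Ā≅B)

complementL : ∀ {m} → LGraph m → LGraph m
complementL L = record { graph = complement (graph L) ; label = label L }

Match-complement : ∀ {m N} (Γ : Graph N) (θ : Vec (Fin N) m) (L : LGraph m) → InjVec θ →
  Match (complement Γ) θ L → Match Γ θ (complementL L)
Match-complement Γ θ L inj match i j with i ≟F j
... | yes refl = trans (adj-irrefl Γ _) (sym (compAdj-irrefl (graph L) _))
... | no i≢j   = begin
  adj Γ (lookup θ i) (lookup θ j)              ≡⟨ not-involutive _ ⟨
  not (not (adj Γ (lookup θ i) (lookup θ j)))  ≡⟨ cong not (compAdj-≢ Γ (λ e → i≢j (inj i j e))) ⟨
  not (compAdj Γ (lookup θ i) (lookup θ j))    ≡⟨ cong not (match i j) ⟩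
  not (adj (graph L) (π ⟨$⟩ʳ i) (π ⟨$⟩ʳ j))    ≡⟨ compAdj-≢ (graph L) (λ e → i≢j (⟨$⟩ʳ-injective π e)) ⟨
  compAdj (graph L) (π ⟨$⟩ʳ i) (π ⟨$⟩ʳ j)      ∎
  where
  open ≡-Reasoning
  π = label L

IsIndependent⇒IsClique-complement : ∀ {m} (H : Graph m) W → IsIndependent H W → IsClique (complement H) W
IsIndependent⇒IsClique-complement H W indep u v u∈W v∈W u≢v = compAdj-false⇒true H u≢v (indep u v u∈W v∈W)

DeletedWithin-complement⇒AddedWithin : ∀ {m} (H : Graph m) W D →
  DeletedWithin (complement H) W D → AddedWithin H W (complement D)
DeletedWithin-complement⇒AddedWithin H W D (D⊆H̄ , deletedInside , x , y , h̄ , d) =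
  H⊆D̄ , addedInside , x , y , compAdj-false⇒true D (adj-true⇒≢ (complement H) h̄) d , compAdj-true H h̄
  where
  H⊆D̄ : ∀ x y → adj H x y ≡ true → compAdj D x y ≡ true
  H⊆D̄ x y h = compAdj-false⇒true D (adj-true⇒≢ H h)
    (¬-not λ d → contradiction (trans (sym h) (compAdj-true H (D⊆H̄ x y d))) λ ())

  addedInside : ∀ x y → compAdj D x y ≡ true → adj H x y ≡ false → x ∈ˢ W × y ∈ˢ W
  addedInside x y d̄ h = deletedInside x y (compAdj-false⇒true H (adj-true⇒≢ (complement D) d̄) h) (compAdj-true D d̄)

ColStrEmb-𝓒 : ∀ {k r n} (𝓗 : List (LGraph (k + r))) (H : Graph (k + r)) (G : Graph n) (fG : Fin n → Fin k)
  (U : Subset (k + r)) → ∣ U ∣ ≡ k → IsClique H U →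
  (∀ L′ → L′ ∈ 𝓗 → ∀ D → DeletedWithin H U D → ¬ Iso (graph L′) D) →
  (fH : Permutation′ (k + r)) → (∀ u → u ∈ˢ U → toℕ (fH ⟨$⟩ʳ u) < k) →
  ColStrEmb 𝓗 (𝓒 G fG H U fH) (f𝓒 fG) ≡ ColStrEmb (restrict 𝓗 H) (𝓒 G fG H U fH) (f𝓒 fG)
ColStrEmb-𝓒 𝓗 H G fG U ∣U∣≡k clique noDeletion fH fH[U]<k =
  ColStrEmb-restrict 𝓗 (𝓒 G fG H U fH) (f𝓒 fG) H λ θ inj col {L′} L′∈𝓗 match →
    [ (λ L′≅H → L′≅H) , (λ (D , deleted , L′≅D) → ⊥-elim (noDeletion L′ L′∈𝓗 D deleted L′≅D)) ]′
      (CliqueGadget.copies G fG H U fH ∣U∣≡k fH[U]<k clique θ inj col L′ match)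

ColStrEmb-𝓒bar : ∀ {k r n} (𝓗 : List (LGraph (k + r))) (H : Graph (k + r)) (G : Graph n) (fG : Fin n → Fin k)
  (W : Subset (k + r)) → ∣ W ∣ ≡ k → IsIndependent H W →
  (∀ L′ → L′ ∈ 𝓗 → ∀ A → AddedWithin H W A → ¬ Iso (graph L′) A) →
  (fH : Permutation′ (k + r)) → (∀ u → u ∈ˢ W → toℕ (fH ⟨$⟩ʳ u) < k) →
  ColStrEmb 𝓗 (𝓒bar G fG H W fH) (f𝓒 fG) ≡ ColStrEmb (restrict 𝓗 H) (𝓒bar G fG H W fH) (f𝓒 fG)
ColStrEmb-𝓒bar 𝓗 H G fG W ∣W∣≡k indep noAddition fH fH[W]<k =
  ColStrEmb-restrict 𝓗 (𝓒bar G fG H W fH) (f𝓒 fG) H λ θ inj col {L′} L′∈𝓗 match →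
    [ (λ L̄′≅H̄ → Iso-resp-≗ {A = graph L′} {graph L′} {complement (complement H)} {H}
                  (λ _ _ → refl) (complement-involutive H) (Iso-complementˡ (graph L′) (complement H) L̄′≅H̄))
    , (λ (D , deleted , L̄′≅D) → ⊥-elim (noAddition L′ L′∈𝓗 (complement D)
         (DeletedWithin-complement⇒AddedWithin H W D deleted) (Iso-complementˡ (graph L′) D L̄′≅D)))
    ]′
      (CliqueGadget.copies G fG (complement H) W fH ∣W∣≡k fH[W]<k
        (IsIndependent⇒IsClique-complement H W indep) θ inj col (complementL L′)
        (Match-complement (𝓒 G fG (complement H) W fH) θ L′ inj match))

mainTheorem7 : (k r n : ℕ) (𝓗 : List (LGraph (k + r))) (L : LGraph (k + r)) → L ∈ 𝓗 →
    (G : Graph n) (fG : Fin n → Fin k) →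
    ((U : Subset (k + r)) → ∣ U ∣ ≡ k → IsClique (graph L) U →
      (∀ L′ → L′ ∈ 𝓗 → ∀ D → DeletedWithin (graph L) U D → ¬ Iso (graph L′) D) →
      (fH : Permutation′ (k + r)) → (∀ u → u ∈ˢ U → toℕ (fH ⟨$⟩ʳ u) < k) →
      ColStrEmb 𝓗 (𝓒 G fG (graph L) U fH) (f𝓒 fG)
        ≡ ColStrEmb (restrict 𝓗 (graph L)) (𝓒 G fG (graph L) U fH) (f𝓒 fG))
    ×
    ((W : Subset (k + r)) → ∣ W ∣ ≡ k → IsIndependent (graph L) W →
      (∀ L′ → L′ ∈ 𝓗 → ∀ A → AddedWithin (graph L) W A → ¬ Iso (graph L′) A) →
      (fH : Permutation′ (k + r)) → (∀ u → u ∈ˢ W → toℕ (fH ⟨$⟩ʳ u) < k) →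
      ColStrEmb 𝓗 (𝓒bar G fG (graph L) W fH) (f𝓒 fG)
        ≡ ColStrEmb (restrict 𝓗 (graph L)) (𝓒bar G fG (graph L) W fH) (f𝓒 fG))
mainTheorem7 k r n 𝓗 L _ G fG = ColStrEmb-𝓒 𝓗 (graph L) G fG , ColStrEmb-𝓒bar 𝓗 (graph L) G fG
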